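{- Let $C$ be an ordered field and let $\mathbb{M}$ be a model of $T_{\mathrm{Ham}}$ with underlying set $G_\infty$. Then there are (1) a definable subset $H\subseteq G$ which is $C$-linearly independent and dense in $(G,<_0)$, and (2) a definable subset $S\subsetneq G$ which is the underlying set of an elementary substructure of the ordered $C$-vector space $(G;+,<_0,(\lambda_c)_{c\in C})$.
   Context: A $2$-ordered $C$-vector space is a $C$-vector space $G$ with two linear orders $<_0,<_1$, each making $G$ an ordered $C$-vector space (ordered abelian group with $\lambda>0,x>0\Rightarrow\lambda x>0$ for $\lambda\in C$). Put $G_\infty=G\cup\{\infty\}$ with $\infty$ above $G$ in both orders. A Hamel valuation on $G$ is a map $v:G\to G_\infty$ such that for all $x,y\in G$, $\lambda\in C\setminus\{0\}$: $v(x)=\infty$ iff $x=0$; $v(x+y)\geq_0\min_0(v(x),v(y))$; $v(\lambda x)=v(x)$; if $0<_1x<_1y$ then $v(x)\geq_0v(y)$; $v(v(x))=v(x)$ (with $v(\infty)=\infty$); and $v(x)>_10$. A Hamel space $(G,v)$ is independent if for all $a_0<_0b_0$, $a_1<_1b_1$ in $G\cup\{\pm\infty\}$ there is $z\in G$ with $a_0<_0z<_0b_0$ and $a_1<_1z<_1b_1$; dense if for all $a<_0b$ in $G$ there is $c\in G$ with $a<_0v(c)<_0b$. $T_{\mathrm{Ham}}$ is the theory, in the language $\{0,+,(\lambda_c)_{c\in C},<_0,<_1,v,\infty\}$ (structures on $G_\infty$ with $\lambda_c$ scalar multiplication and $\infty$ as default value for $+,\lambda_c,v$), whose models are exactly the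 independent dense Hamel spaces over $C$. "Definable" means definable in $\mathbb{M}$; $H$ dense in $(G,<_0)$ means every nonempty open $<_0$-interval of $G$ meets $H$. -}

module Defs where

open import Level using (0ℓ)
open import Data.Nat using (ℕ; suc)
open import Data.Fin using (Fin)
open import Data.Maybe using (Maybe; just; nothing)
open import Data.Product using (Σ; Σ-syntax; _×_; _,_; proj₁; proj₂)
open import Data.Sum using (_⊎_)
open import Data.Unit using (⊤)
open import Data.Empty using (⊥)
open import Data.List using (List; map; foldr)
open import Data.List.Relation.Unary.All using (All)
open import Data.List.Relation.Unary.Unique.Propositional using (Unique)
open import Data.Vec.Functional using (_∷_)
open import Function using (_∘_)
open import Function.Bundles using (_⇔_)
open import Relation.Nullary using (¬_)
open import Relation.Binary.Core using (Rel)
open import Relation.Binary.Structures using (IsStrictTotalOrder)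
open import Relation.Binary.PropositionalEquality using (_≡_)
open import Algebra.Core using (Op₁; Op₂)
open import Algebra.Structures using (IsCommutativeRing)
open import Algebra.Bundles using (CommutativeRing; Ring)
open import Algebra.Module.Structures using (IsLeftModule)

record OrderedField : Set₁ where
  infixl 6 _+_
  infixl 7 _*_
  field
    Carrier : Set
    _+_ _*_ : Op₂ Carrier
    -_ : Op₁ Carrier
    0# 1# : Carrier
    isCommutativeRing : IsCommutativeRing _≡_ _+_ _*_ -_ 0# 1#
    0≢1 : ¬ (0# ≡ 1#)
    inverse : ∀ x → ¬ (x ≡ 0#) → Σ[ y ∈ Carrier ] (x * y ≡ 1#)
    _<_ : Rel Carrier 0ℓ
    <-isStrictTotalOrder : IsStrictTotalOrder _≡_ _<_
    +-mono-< : ∀ {x y} z → x < y → (x + z) < (y + z)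
    *-pos : ∀ {x y} → 0# < x → 0# < y → 0# < (x * y)

  commutativeRing : CommutativeRing 0ℓ 0ℓ
  commutativeRing = record { isCommutativeRing = isCommutativeRing }

  ring : Ring 0ℓ 0ℓ
  ring = CommutativeRing.ring commutativeRing

-- Orders extended to G_∞ = Maybe G (nothing = ∞, above everything)

module _ {G : Set} (_<_ : Rel G 0ℓ) where
  _<∞_ : Rel (Maybe G) 0ℓ
  just a  <∞ just b  = a < b
  just a  <∞ nothing = ⊤
  nothing <∞ _       = ⊥

  _≤∞_ : Rel (Maybe G) 0ℓ
  a ≤∞ b = (a <∞ b) ⊎ (a ≡ b)

data Ext (G : Set) : Set where
  -∞ +∞ : Ext G
  fin : G → Ext G

module _ {G : Set} (_<_ : Rel G 0ℓ) where
  _<±_ : Rel (Ext G) 0ℓ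
  -∞    <± -∞    = ⊥
  -∞    <± _     = ⊤
  fin a <± fin b = a < b
  fin a <± +∞    = ⊤
  _     <± _     = ⊥

-- Independent dense Hamel spaces over C (= models of T_Ham)

record HamelSpace (F : OrderedField) : Set₁ where
  open OrderedField F renaming (Carrier to C; _<_ to _<C_; _+_ to _+C_)
  infixl 6 _+ᴳ_
  field
    G : Set
    _+ᴳ_ : Op₂ G
    0ᴳ : G
    -ᴳ_ : Op₁ G
    _·_ : C → G → G
    isLeftModule : IsLeftModule ring _≡_ _+ᴳ_ 0ᴳ -ᴳ_ _·_
    _<₀_ _<₁_ : Rel G 0ℓ
    <₀-isStrictTotalOrder : IsStrictTotalOrder _≡_ _<₀_
    <₁-isStrictTotalOrder : IsStrictTotalOrder _≡_ _<₁_
    <₀-+-mono : ∀ {x y} z → x <₀ y → (x +ᴳ z) <₀ (y +ᴳ z)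
    <₁-+-mono : ∀ {x y} z → x <₁ y → (x +ᴳ z) <₁ (y +ᴳ z)
    <₀-·-pos : ∀ {c x} → 0# <C c → 0ᴳ <₀ x → 0ᴳ <₀ (c · x)
    <₁-·-pos : ∀ {c x} → 0# <C c → 0ᴳ <₁ x → 0ᴳ <₁ (c · x)
    v : G → Maybe G
    v-∞ : ∀ x → (v x ≡ nothing) ⇔ (x ≡ 0ᴳ)
    v-ultra : ∀ x y → (_≤∞_ _<₀_ (v x) (v (x +ᴳ y))) ⊎ (_≤∞_ _<₀_ (v y) (v (x +ᴳ y)))
    v-scal : ∀ c x → ¬ (c ≡ 0#) → v (c · x) ≡ v x
    v-mono : ∀ {x y} → 0ᴳ <₁ x → x <₁ y → _≤∞_ _<₀_ (v y) (v x)
    v-idem : ∀ x → (∀ g → v x ≡ just g → v g ≡ v x)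
    v-pos : ∀ x → _<∞_ _<₁_ (just 0ᴳ) (v x)
    independent : ∀ (a₀ b₀ a₁ b₁ : Ext G) → _<±_ _<₀_ a₀ b₀ → _<±_ _<₁_ a₁ b₁ →
      Σ[ z ∈ G ] (_<±_ _<₀_ a₀ (fin z) × _<±_ _<₀_ (fin z) b₀ ×
                  _<±_ _<₁_ a₁ (fin z) × _<±_ _<₁_ (fin z) b₁)
    dense : ∀ a b → a <₀ b → Σ[ c ∈ G ] (_<∞_ _<₀_ (just a) (v c) × _<∞_ _<₀_ (v c) (just b))

data Fm (A : ℕ → Set) : ℕ → Set where
  atom : ∀ {n} → A n → Fm A n
  ⊥′ : ∀ {n} → Fm A n
  _⇒_ _∧′_ _∨′_ : ∀ {n} → Fm A n → Fm A n → Fm A n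
  ∀′ ∃′ : ∀ {n} → Fm A (suc n) → Fm A n

Sat : ∀ {A : ℕ → Set} {D : Set} → (∀ {n} → A n → (Fin n → D) → Set) →
      ∀ {n} → Fm A n → (Fin n → D) → Set
Sat I (atom a) ρ = I a ρ
Sat I ⊥′ ρ = ⊥
Sat I (φ ⇒ ψ) ρ = Sat I φ ρ → Sat I ψ ρ
Sat I (φ ∧′ ψ) ρ = Sat I φ ρ × Sat I ψ ρ
Sat I (φ ∨′ ψ) ρ = Sat I φ ρ ⊎ Sat I ψ ρ
Sat {D = D} I (∀′ φ) ρ = (d : D) → Sat I φ (d ∷ ρ)
Sat {D = D} I (∃′ φ) ρ = Σ[ d ∈ D ] Sat I φ (d ∷ ρ)

module _ (C : Set) where
  data TermHam (n : ℕ) : Set where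
    var : Fin n → TermHam n
    zero′ inf′ : TermHam n
    add : TermHam n → TermHam n → TermHam n
    scal : C → TermHam n → TermHam n
    val : TermHam n → TermHam n

  data AtomHam (n : ℕ) : Set where
    _≐_ _<₀′_ _<₁′_ : TermHam n → TermHam n → AtomHam n

  data TermOVS (n : ℕ) : Set where
    var : Fin n → TermOVS n
    add : TermOVS n → TermOVS n → TermOVS n
    scal : C → TermOVS n → TermOVS n

  data AtomOVS (n : ℕ) : Set where
    _≐_ _<₀′_ : TermOVS n → TermOVS n → AtomOVS n

module Model {F : OrderedField} (𝔾 : HamelSpace F) where
  open OrderedField F renaming (Carrier to C)
  open HamelSpace 𝔾

  -- 𝕄 has universe G_∞ = Maybe G; ∞ is the default value of +, λ_c, v
  addM : Maybe G → Maybe G → Maybe G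
  addM (just a) (just b) = just (a +ᴳ b)
  addM _ _ = nothing

  scalM : C → Maybe G → Maybe G
  scalM c (just a) = just (c · a)
  scalM c nothing = nothing

  vM : Maybe G → Maybe G
  vM (just a) = v a
  vM nothing = nothing

  evalM : ∀ {n} → TermHam C n → (Fin n → Maybe G) → Maybe G
  evalM (var i) ρ = ρ i
  evalM zero′ ρ = just 0ᴳ
  evalM inf′ ρ = nothing
  evalM (add s t) ρ = addM (evalM s ρ) (evalM t ρ)
  evalM (scal c t) ρ = scalM c (evalM t ρ)
  evalM (val t) ρ = vM (evalM t ρ)

  atomM : ∀ {n} → AtomHam C n → (Fin n → Maybe G) → Set
  atomM (s ≐ t) ρ = evalM s ρ ≡ evalM t ρ
  atomM (s <₀′ t) ρ = _<∞_ _<₀_ (evalM s ρ) (evalM t ρ)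
  atomM (s <₁′ t) ρ = _<∞_ _<₁_ (evalM s ρ) (evalM t ρ)

  SatM : ∀ {n} → Fm (AtomHam C) n → (Fin n → Maybe G) → Set
  SatM = Sat atomM

  InG : (G → Set) → Maybe G → Set
  InG P (just g) = P g
  InG P nothing = ⊥

  Definable : (G → Set) → Set
  Definable P = Σ[ n ∈ ℕ ] Σ[ φ ∈ Fm (AtomHam C) (suc n) ] Σ[ ps ∈ (Fin n → Maybe G) ]
                  (∀ x → SatM φ (x ∷ ps) ⇔ InG P x)

  lincomb : List (C × G) → G
  lincomb = foldr (λ p acc → (proj₁ p · proj₂ p) +ᴳ acc) 0ᴳ

  LinearlyIndependent : (G → Set) → Set
  LinearlyIndependent P = ∀ (xs : List (C × G)) → Unique (map proj₂ xs) →
    All (P ∘ proj₂) xs → lincomb xs ≡ 0ᴳ → All (λ p → proj₁ p ≡ 0#) xs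

  DenseIn₀ : (G → Set) → Set
  DenseIn₀ P = ∀ a b → a <₀ b → Σ[ h ∈ G ] (P h × a <₀ h × h <₀ b)

  module _ {D : Set} (addD : D → D → D) (scalD : C → D → D) (emb : D → G) where
    evalV : ∀ {n} → TermOVS C n → (Fin n → D) → D
    evalV (var i) ρ = ρ i
    evalV (add s t) ρ = addD (evalV s ρ) (evalV t ρ)
    evalV (scal c t) ρ = scalD c (evalV t ρ)

    atomV : ∀ {n} → AtomOVS C n → (Fin n → D) → Set
    atomV (s ≐ t) ρ = emb (evalV s ρ) ≡ emb (evalV t ρ)
    atomV (s <₀′ t) ρ = emb (evalV s ρ) <₀ emb (evalV t ρ)

  SatG : ∀ {n} → Fm (AtomOVS C) n → (Fin n → G) → Set
  SatG = Sat (atomV _+ᴳ_ _·_ (λ x → x))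

  record ElementarySubstructure (S : G → Set) : Set where
    field
      nonempty : Σ[ s ∈ G ] S s
      closed-+ : ∀ {a b} → S a → S b → S (a +ᴳ b)
      closed-· : ∀ c {a} → S a → S (c · a)
    Sub : Set
    Sub = Σ[ g ∈ G ] S g
    addS : Sub → Sub → Sub
    addS (a , p) (b , q) = (a +ᴳ b , closed-+ p q)
    scalS : C → Sub → Sub
    scalS c (a , p) = (c · a , closed-· c p)
    SatS : ∀ {n} → Fm (AtomOVS C) n → (Fin n → Sub) → Set
    SatS = Sat (atomV addS scalS proj₁)
    field
      elementary : ∀ {n} (φ : Fm (AtomOVS C) n) (ρ : Fin n → Sub) →
                   SatS φ ρ ⇔ SatG φ (proj₁ ∘ ρ)

module _ {F : OrderedField} (𝔾 : HamelSpace F) where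
  open HamelSpace 𝔾 using (G)
  open Model 𝔾

  Corollary6p1-conclusion : Set₁
  Corollary6p1-conclusion =
    (Σ[ H ∈ (G → Set) ] (Definable H × LinearlyIndependent H × DenseIn₀ H)) ×
    (Σ[ S ∈ (G → Set) ] (Definable S × (Σ[ g ∈ G ] ¬ S g) × ElementarySubstructure S))

module Submission where

-- (1) Take H = {h | v h = h}. By idempotence v c ∈ H whenever c ≠ 0, so density of H is the
-- density axiom. In a combination Σ cᵢ hᵢ of distinct elements of H with nonzero coefficients
-- the summands have the distinct values hᵢ, so the ultrametric inequality is an equality and
-- v (Σ cᵢ hᵢ) is one of the hᵢ; in particular the combination is nonzero.
--
-- (2) Take fixed points δ <₀ γ with 0 <₀ γ and the ball S = {g | γ ≤₀ v g}: a subspace by the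
-- valuation axioms, containing γ but not δ. A nonzero subspace S of an ordered vector space is
-- elementary in it because the theory has quantifier elimination: Fourier–Motzkin elimination
-- turns each formula into a disjunction of conjunctions of linear conditions on its parameters,
-- and every existential witness it needs (the solution of an equation, or a point strictly
-- between finitely many bounds) is built from the parameters by the vector space operations and
-- a positive element, hence lies in S. Excluded middle is used only for ⇒ and ∀.

open import Defs
open import Axiom.ExcludedMiddle using (ExcludedMiddle)
open import Axiom.DoubleNegationElimination using (em⇒dne)
open import Level using (0ℓ)
open import Data.Nat using (ℕ; zero; suc)
open import Data.Fin using (Fin; zero; suc)
open import Data.Maybe using (Maybe; just; nothing)
open import Data.Maybe.Properties using (just-injective)
open import Data.Product using (Σ; Σ-syntax; _×_; _,_; proj₁; proj₂; uncurry)
open import Data.Sum using (_⊎_; inj₁; inj₂)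
open import Data.Unit using (tt)
open import Data.Empty using (⊥-elim)
open import Data.List using (List; []; _∷_; _++_; map; concatMap; foldr; cartesianProductWith)
open import Data.List.Relation.Unary.All as All using (All; []; _∷_)
open import Data.List.Relation.Unary.Any as Any using (Any; here; there)
import Data.List.Relation.Unary.All.Properties as All
import Data.List.Relation.Unary.Any.Properties as Any
open import Data.List.Relation.Unary.AllPairs using (_∷_)
open import Data.List.Relation.Unary.Unique.Propositional using (Unique)
open import Data.List.Membership.Propositional using (_∈_)
open import Data.Vec.Functional using (Vector; head; tail; replicate; zipWith)
  renaming (_∷_ to _∷ᵛ_; map to mapᵛ)
open import Function using (_∘_)
open import Function.Bundles using (_⇔_; mk⇔; Equivalence)
import Function.Properties.Equivalence as ⇔
open import Data.Product.Function.NonDependent.Propositional using (_×-⇔_)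
open import Data.Sum.Function.Propositional using (_⊎-⇔_)
open import Function.Related.TypeIsomorphisms using (→-cong-⇔)
open import Relation.Nullary using (¬_; yes; no)
open import Relation.Binary.Core using (Rel)
open import Relation.Binary.Bundles using (TotalOrder)
open import Relation.Binary.Definitions using (Transitive; Irreflexive; Trichotomous; tri<; tri≈; tri>)
open import Relation.Binary.Structures using (IsStrictTotalOrder)
open import Relation.Binary.PropositionalEquality
  using (_≡_; _≢_; refl; sym; trans; cong; cong₂; subst; subst₂; resp₂; module ≡-Reasoning)
open import Relation.Binary.PropositionalEquality.Properties using (isEquivalence)
import Relation.Binary.Construct.StrictToNonStrict as StrictToNonStrict
import Relation.Binary.Reasoning.Setoid as SetoidReasoning
open import Algebra.Core using (Op₁; Op₂)
open import Algebra.Bundles using (AbelianGroup; Ring)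
open import Algebra.Structures using (IsAbelianGroup; IsCommutativeRing)
open import Algebra.Module.Structures using (IsLeftModule)
import Algebra.Properties.AbelianGroup as AbelianGroupProperties
import Algebra.Properties.CommutativeSemigroup as CommutativeSemigroupProperties
import Algebra.Properties.Ring as RingProperties
import Data.List.Extrema as Extrema

module ⇔-Reasoning = SetoidReasoning (⇔.⇔-setoid 0ℓ)

module Logic where

  ≡⇒⇔ : ∀ {A B : Set} → A ≡ B → A ⇔ B
  ≡⇒⇔ refl = ⇔.refl

  All-cong : ∀ {A : Set} {P Q : A → Set} {xs} → (∀ {x} → P x ⇔ Q x) → All P xs ⇔ All Q xs
  All-cong P⇔Q = mk⇔ (All.map (Equivalence.to P⇔Q)) (All.map (Equivalence.from P⇔Q))

  Any-cong : ∀ {A : Set} {P Q : A → Set} {xs} → (∀ {x} → P x ⇔ Q x) → Any P xs ⇔ Any Q xs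
  Any-cong P⇔Q = mk⇔ (Any.map (Equivalence.to P⇔Q)) (Any.map (Equivalence.from P⇔Q))

  Σ-cong : ∀ {A : Set} {P Q : A → Set} → (∀ {x} → P x ⇔ Q x) → Σ A P ⇔ Σ A Q
  Σ-cong P⇔Q = mk⇔ (λ (x , p) → x , Equivalence.to P⇔Q p) (λ (x , q) → x , Equivalence.from P⇔Q q)

  ¬-cong : ∀ {A B : Set} → A ⇔ B → (¬ A) ⇔ (¬ B)
  ¬-cong A⇔B = mk⇔ (λ ¬a b → ¬a (Equivalence.from A⇔B b)) (λ ¬b a → ¬b (Equivalence.to A⇔B a))

  All-map : ∀ {A B : Set} {P : B → Set} {f : A → B} {xs} → All P (map f xs) ⇔ All (P ∘ f) xs
  All-map = mk⇔ All.map⁻ All.map⁺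

  Any-map : ∀ {A B : Set} {P : B → Set} {f : A → B} {xs} → Any P (map f xs) ⇔ Any (P ∘ f) xs
  Any-map = mk⇔ Any.map⁻ Any.map⁺

  All-++ : ∀ {A : Set} {P : A → Set} {xs ys} → All P (xs ++ ys) ⇔ (All P xs × All P ys)
  All-++ {xs = xs} = mk⇔ (All.++⁻ xs) (uncurry All.++⁺)

  Any-++ : ∀ {A : Set} {P : A → Set} {xs ys} → Any P (xs ++ ys) ⇔ (Any P xs ⊎ Any P ys)
  Any-++ {xs = xs} {ys} = mk⇔ (Any.++⁻ xs) λ { (inj₁ p) → Any.++⁺ˡ p ; (inj₂ p) → Any.++⁺ʳ xs p }

  All-∷ : ∀ {A : Set} {P : A → Set} {x xs} → All P (x ∷ xs) ⇔ (P x × All P xs)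
  All-∷ = mk⇔ (λ { (p ∷ ps) → p , ps }) (uncurry _∷_)

  ¬Any⇔All¬ : ∀ {A : Set} {P : A → Set} {xs} → (¬ Any P xs) ⇔ All (¬_ ∘ P) xs
  ¬Any⇔All¬ {xs = xs} = mk⇔ (All.¬Any⇒All¬ xs) All.All¬⇒¬Any

  Σ-Any : ∀ {A B : Set} {P : A → B → Set} {ys} →
          (Σ[ x ∈ A ] Any (P x) ys) ⇔ Any (λ y → Σ[ x ∈ A ] P x y) ys
  Σ-Any {A} {P = P} = mk⇔ (λ (x , p) → Any.map (x ,_) p) from
    where
    from : ∀ {ys} → Any (λ y → Σ[ x ∈ A ] P x y) ys → Σ[ x ∈ A ] Any (P x) ys
    from (here (x , p)) = x , here p
    from (there q) = let (x , p) = from q in x , there p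

  module Classical (em : ExcludedMiddle 0ℓ) where

    ¬All⇔Any¬ : ∀ {A : Set} {P : A → Set} {xs} → (¬ All P xs) ⇔ Any (¬_ ∘ P) xs
    ¬All⇔Any¬ {xs = xs} = mk⇔ (All.¬All⇒Any¬ (λ _ → em) xs) All.Any¬⇒¬All

    →⇔¬⊎ : ∀ {A B : Set} → (A → B) ⇔ (¬ A ⊎ B)
    →⇔¬⊎ {A} = mk⇔ to λ { (inj₁ ¬a) a → ⊥-elim (¬a a) ; (inj₂ b) _ → b }
      where
      to : ∀ {B} → (A → B) → ¬ A ⊎ B
      to f with em {A}
      ... | yes a = inj₂ (f a)
      ... | no ¬a = inj₁ ¬a

    Π⇔¬Σ¬ : ∀ {A : Set} {P : A → Set} → ((x : A) → P x) ⇔ (¬ (Σ[ x ∈ A ] ¬ P x))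
    Π⇔¬Σ¬ = mk⇔ (λ f (x , ¬p) → ¬p (f x)) (λ ¬∃ x → em⇒dne em (λ ¬p → ¬∃ (x , ¬p)))

module OrderedAbelianGroupProperties
  {A : Set} {op : Op₂ A} {ε : A} {inv : Op₁ A} {lt : Rel A 0ℓ}
  (isAbelianGroup : IsAbelianGroup _≡_ op ε inv)
  (isStrictTotalOrder : IsStrictTotalOrder _≡_ lt)
  (∙-monoˡ-< : ∀ {x y} z → lt x y → lt (op x z) (op y z))
  where

  private
    infixl 7 _∙_
    infix 8 _⁻¹
    infix 4 _<_
    _∙_ : Op₂ A
    _∙_ = op
    _⁻¹ : Op₁ A
    _⁻¹ = inv
    _<_ : Rel A 0ℓ
    _<_ = lt

  open IsAbelianGroup isAbelianGroup using (comm; identityˡ; identityʳ; inverseˡ; inverseʳ)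
  open IsStrictTotalOrder isStrictTotalOrder using (compare; irrefl; asym)
  private
    abelianGroup : AbelianGroup 0ℓ 0ℓ
    abelianGroup = record { isAbelianGroup = isAbelianGroup }

  open AbelianGroupProperties abelianGroup using (//-rightDividesˡ)

  ∙-monoʳ-< : ∀ {x y} z → x < y → z ∙ x < z ∙ y
  ∙-monoʳ-< {x} {y} z x<y = subst₂ _<_ (comm x z) (comm y z) (∙-monoˡ-< z x<y)

  ε<x∙y⁻¹⇔y<x : ∀ {x y} → ε < x ∙ y ⁻¹ ⇔ y < x
  ε<x∙y⁻¹⇔y<x {x} {y} = mk⇔
    (λ ε<x-y → subst₂ _<_ (identityˡ y) (//-rightDividesˡ y x) (∙-monoˡ-< y ε<x-y))
    (λ y<x → subst₂ _<_ (inverseʳ y) refl (∙-monoˡ-< (y ⁻¹) y<x))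

  x∙y⁻¹<ε⇔x<y : ∀ {x y} → x ∙ y ⁻¹ < ε ⇔ x < y
  x∙y⁻¹<ε⇔x<y {x} {y} = mk⇔
    (λ x-y<ε → subst₂ _<_ (//-rightDividesˡ y x) (identityˡ y) (∙-monoˡ-< y x-y<ε))
    (λ x<y → subst₂ _<_ refl (inverseʳ y) (∙-monoˡ-< (y ⁻¹) x<y))

  ε<x⁻¹⇔x<ε : ∀ {x} → ε < x ⁻¹ ⇔ x < ε
  ε<x⁻¹⇔x<ε {x} = mk⇔
    (λ ε<-x → subst₂ _<_ (identityˡ x) (inverseˡ x) (∙-monoˡ-< x ε<-x))
    (λ x<ε → subst₂ _<_ (inverseʳ x) (identityˡ (x ⁻¹)) (∙-monoˡ-< (x ⁻¹) x<ε))

  x<x∙y : ∀ x {y} → ε < y → x < x ∙ y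
  x<x∙y x ε<y = subst₂ _<_ (identityʳ x) refl (∙-monoʳ-< x ε<y)

  x∙y<x : ∀ x {y} → y < ε → x ∙ y < x
  x∙y<x x y<ε = subst₂ _<_ refl (identityʳ x) (∙-monoʳ-< x y<ε)

  ε<x∙y : ∀ {x y} → ε < x → ε < y → ε < x ∙ y
  ε<x∙y {x} ε<x ε<y = IsStrictTotalOrder.trans isStrictTotalOrder ε<x (x<x∙y x ε<y)

  x≢ε⇔ : ∀ {x} → x ≢ ε ⇔ (ε < x ⊎ x < ε)
  x≢ε⇔ {x} = mk⇔ to λ { (inj₁ ε<x) x≡ε → irrefl (sym x≡ε) ε<x ; (inj₂ x<ε) x≡ε → irrefl x≡ε x<ε }
    where
    to : x ≢ ε → ε < x ⊎ x < ε
    to x≢ε with compare ε x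
    ... | tri< ε<x _ _ = inj₁ ε<x
    ... | tri≈ _ ε≡x _ = ⊥-elim (x≢ε (sym ε≡x))
    ... | tri> _ _ x<ε = inj₂ x<ε

  ε≮x⇔ : ∀ {x} → (¬ ε < x) ⇔ (x ≡ ε ⊎ x < ε)
  ε≮x⇔ {x} = mk⇔ to λ { (inj₁ refl) → irrefl refl ; (inj₂ x<ε) ε<x → asym x<ε ε<x }
    where
    to : ¬ ε < x → x ≡ ε ⊎ x < ε
    to ε≮x with compare ε x
    ... | tri< ε<x _ _ = ⊥-elim (ε≮x ε<x)
    ... | tri≈ _ ε≡x _ = inj₁ (sym ε≡x)
    ... | tri> _ _ x<ε = inj₂ x<ε

module OrderedFieldProperties (F : OrderedField) where

  open OrderedField F renaming (_<_ to infix 4 _<_; -_ to infix 8 -_)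
  open IsCommutativeRing isCommutativeRing
    using (+-isAbelianGroup; *-comm; zeroʳ; *-identityˡ)
  open RingProperties ring using (-‿distribˡ-*; -‿distribʳ-*)
  open IsStrictTotalOrder <-isStrictTotalOrder using (compare; irrefl; asym)
  open AbelianGroupProperties (Ring.+-abelianGroup ring)
    using () renaming (⁻¹-involutive to -‿involutive)
  open OrderedAbelianGroupProperties +-isAbelianGroup <-isStrictTotalOrder +-mono-<

  -1*-1≡1 : (- 1#) * (- 1#) ≡ 1#
  -1*-1≡1 = begin
    (- 1#) * (- 1#)  ≡⟨ -‿distribˡ-* 1# (- 1#) ⟨
    - (1# * (- 1#))  ≡⟨ cong -_ (*-identityˡ (- 1#)) ⟩
    - (- 1#)         ≡⟨ -‿involutive 1# ⟩
    1#               ∎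
    where open ≡-Reasoning

  0<x⇒x≢0 : ∀ {x} → 0# < x → x ≢ 0#
  0<x⇒x≢0 0<x x≡0 = irrefl (sym x≡0) 0<x

  x<0⇒x≢0 : ∀ {x} → x < 0# → x ≢ 0#
  x<0⇒x≢0 x<0 x≡0 = irrefl x≡0 x<0

  x<0⇒0<-x : ∀ {x} → x < 0# → 0# < - x
  x<0⇒0<-x = Equivalence.from ε<x⁻¹⇔x<ε

  0<1 : 0# < 1#
  0<1 with compare 0# 1#
  ... | tri< 0<1 _ _ = 0<1
  ... | tri≈ _ 0≡1 _ = ⊥-elim (0≢1 0≡1)
  ... | tri> _ _ 1<0 = ⊥-elim (asym 1<0 (subst (0# <_) -1*-1≡1 (*-pos 0<-1 0<-1)))
    where
    0<-1 : 0# < - 1#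
    0<-1 = x<0⇒0<-x 1<0

  -1<0 : - 1# < 0#
  -1<0 = Equivalence.to ε<x⁻¹⇔x<ε (subst (0# <_) (sym (-‿involutive 1#)) 0<1)

  0<x⇒x*y≡1⇒0<y : ∀ {x y} → 0# < x → x * y ≡ 1# → 0# < y
  0<x⇒x*y≡1⇒0<y {x} {y} 0<x xy≡1 with compare 0# y
  ... | tri< 0<y _ _ = 0<y
  ... | tri≈ _ refl _ = ⊥-elim (0≢1 (trans (sym (zeroʳ x)) xy≡1))
  ... | tri> _ _ y<0 = ⊥-elim (asym -1<0 0<-1)
    where
    0<-1 : 0# < - 1#
    0<-1 = subst (λ z → 0# < - z) xy≡1
             (subst (0# <_) (sym (-‿distribʳ-* x y)) (*-pos 0<x (x<0⇒0<-x y<0)))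

  2# : Carrier
  2# = 1# + 1#

  0<2 : 0# < 2#
  0<2 = ε<x∙y 0<1 0<1

  2≢0 : 2# ≢ 0#
  2≢0 = 0<x⇒x≢0 0<2

  ½ : Carrier
  ½ = proj₁ (inverse 2# 2≢0)

  ½*2≡1 : ½ * 2# ≡ 1#
  ½*2≡1 = trans (*-comm ½ 2#) (proj₂ (inverse 2# 2≢0))

  0<½ : 0# < ½
  0<½ = 0<x⇒x*y≡1⇒0<y 0<2 (trans (*-comm 2# ½) ½*2≡1)

module HamelSpaceTheory {F : OrderedField} (𝔾 : HamelSpace F) where

  open OrderedField F
    using (0#; 1#; _+_; _*_; inverse; isCommutativeRing; <-isStrictTotalOrder)
    renaming (Carrier to C; _<_ to infix 4 _<_; -_ to infix 8 -_)
  open IsCommutativeRing isCommutativeRing using (*-comm; -‿inverseʳ)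
  open OrderedFieldProperties F using (0<x⇒x≢0; x<0⇒x≢0; x<0⇒0<-x; -1<0; ½; ½*2≡1; 0<½)
  open HamelSpace 𝔾
    renaming (_<₀_ to infix 4 _<₀_; _·_ to infixr 7 _·_; -ᴳ_ to infix 8 -ᴳ_)
  open Model 𝔾
  open IsLeftModule isLeftModule
  open IsStrictTotalOrder <₀-isStrictTotalOrder using (compare; irrefl; asym)
    renaming (trans to <₀-trans)
  open IsStrictTotalOrder <-isStrictTotalOrder using ()
    renaming (_≟_ to _C≟_; compare to C-compare)

  +ᴳ-abelianGroup : AbelianGroup 0ℓ 0ℓ
  +ᴳ-abelianGroup = record { isAbelianGroup = +ᴹ-isAbelianGroup }

  open AbelianGroupProperties +ᴳ-abelianGroup
    using (inverseʳ-unique; //-rightDividesʳ; x∙y⁻¹≈ε⇒x≈y; x≈y⇒x∙y⁻¹≈ε)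
    renaming (⁻¹-involutive to -ᴳ-involutive)
  open CommutativeSemigroupProperties (AbelianGroup.commutativeSemigroup +ᴳ-abelianGroup) using (interchange)
  open OrderedAbelianGroupProperties +ᴹ-isAbelianGroup <₀-isStrictTotalOrder <₀-+-mono
  open Logic

  -- Ordered vector spaces

  ·-neg : ∀ c x → c · (-ᴳ x) ≡ -ᴳ (c · x)
  ·-neg c x = inverseʳ-unique (c · x) (c · (-ᴳ x)) (begin
    c · x +ᴳ c · (-ᴳ x)  ≡⟨ *ₗ-distribˡ c x (-ᴳ x) ⟨
    c · (x +ᴳ -ᴳ x)      ≡⟨ cong (c ·_) (-ᴹ‿inverseʳ x) ⟩
    c · 0ᴳ               ≡⟨ *ₗ-zeroʳ c ⟩
    0ᴳ                   ∎)
    where open ≡-Reasoning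

  neg-· : ∀ c x → (- c) · x ≡ -ᴳ (c · x)
  neg-· c x = inverseʳ-unique (c · x) ((- c) · x) (begin
    c · x +ᴳ (- c) · x  ≡⟨ *ₗ-distribʳ x c (- c) ⟨
    (c + - c) · x       ≡⟨ cong (_· x) (-‿inverseʳ c) ⟩
    0# · x              ≡⟨ *ₗ-zeroˡ x ⟩
    0ᴳ                  ∎)
    where open ≡-Reasoning

  -1·x≡-x : ∀ x → (- 1#) · x ≡ -ᴳ x
  -1·x≡-x x = trans (neg-· 1# x) (cong -ᴳ_ (*ₗ-identityˡ x))

  ·-monoʳ-<₀ : ∀ {c x y} → 0# < c → x <₀ y → c · x <₀ c · y
  ·-monoʳ-<₀ {c} {x} {y} 0<c x<y = Equivalence.to ε<x∙y⁻¹⇔y<x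
    (subst (0ᴳ <₀_) (trans (*ₗ-distribˡ c y (-ᴳ x)) (cong (c · y +ᴳ_) (·-neg c x)))
      (<₀-·-pos 0<c (Equivalence.from ε<x∙y⁻¹⇔y<x x<y)))

  0<₀c·y⇔0<₀y : ∀ {c y} → 0# < c → 0ᴳ <₀ c · y ⇔ 0ᴳ <₀ y
  0<₀c·y⇔0<₀y {c} {y} 0<c = mk⇔ to (<₀-·-pos 0<c)
    where
    to : 0ᴳ <₀ c · y → 0ᴳ <₀ y
    to 0<cy with compare 0ᴳ y
    ... | tri< 0<y _ _ = 0<y
    ... | tri≈ _ refl _ = ⊥-elim (irrefl (sym (*ₗ-zeroʳ c)) 0<cy)
    ... | tri> _ _ y<0 = ⊥-elim (asym 0<cy (Equivalence.to ε<x⁻¹⇔x<ε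
      (subst (0ᴳ <₀_) (·-neg c y) (<₀-·-pos 0<c (Equivalence.from ε<x⁻¹⇔x<ε y<0)))))

  0<₀c·y⇔y<₀0 : ∀ {c y} → c < 0# → 0ᴳ <₀ c · y ⇔ y <₀ 0ᴳ
  0<₀c·y⇔y<₀0 {c} {y} c<0 = begin
    0ᴳ <₀ c · y              ≡⟨ cong (0ᴳ <₀_) c·y≡[-c]·[-y] ⟩
    0ᴳ <₀ (- c) · (-ᴳ y)     ≈⟨ 0<₀c·y⇔0<₀y (x<0⇒0<-x c<0) ⟩
    0ᴳ <₀ -ᴳ y               ≈⟨ ε<x⁻¹⇔x<ε ⟩
    y <₀ 0ᴳ                  ∎
    where
    open ⇔-Reasoning
    c·y≡[-c]·[-y] : c · y ≡ (- c) · (-ᴳ y)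
    c·y≡[-c]·[-y] = sym (trans (neg-· c (-ᴳ y)) (trans (cong -ᴳ_ (·-neg c y)) (-ᴳ-involutive (c · y))))

  c·y≡0⇔y≡0 : ∀ {c y} → c ≢ 0# → c · y ≡ 0ᴳ ⇔ y ≡ 0ᴳ
  c·y≡0⇔y≡0 {c} {y} c≢0 = mk⇔ to λ { refl → *ₗ-zeroʳ c }
    where
    to : c · y ≡ 0ᴳ → y ≡ 0ᴳ
    to cy≡0 with inverse c c≢0
    ... | c⁻¹ , cc⁻¹≡1 = begin
      y              ≡⟨ *ₗ-identityˡ y ⟨
      1# · y         ≡⟨ cong (_· y) (trans (*-comm c⁻¹ c) cc⁻¹≡1) ⟨
      (c⁻¹ * c) · y  ≡⟨ *ₗ-assoc c⁻¹ c y ⟩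
      c⁻¹ · (c · y)  ≡⟨ cong (c⁻¹ ·_) cy≡0 ⟩
      c⁻¹ · 0ᴳ       ≡⟨ *ₗ-zeroʳ c⁻¹ ⟩
      0ᴳ             ∎
      where open ≡-Reasoning

  ½·[x+x]≡x : ∀ x → ½ · (x +ᴳ x) ≡ x
  ½·[x+x]≡x x = begin
    ½ · (x +ᴳ x)             ≡⟨ cong (λ y → ½ · (y +ᴳ y)) (*ₗ-identityˡ x) ⟨
    ½ · (1# · x +ᴳ 1# · x)   ≡⟨ cong (½ ·_) (*ₗ-distribʳ x 1# 1#) ⟨
    ½ · ((1# + 1#) · x)      ≡⟨ *ₗ-assoc ½ (1# + 1#) x ⟨
    (½ * (1# + 1#)) · x      ≡⟨ cong (_· x) ½*2≡1 ⟩
    1# · x                   ≡⟨ *ₗ-identityˡ x ⟩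
    x                        ∎
    where open ≡-Reasoning

  x<₀½·[x+y] : ∀ {x y} → x <₀ y → x <₀ ½ · (x +ᴳ y)
  x<₀½·[x+y] {x} {y} x<y = subst (_<₀ ½ · (x +ᴳ y)) (½·[x+x]≡x x) (·-monoʳ-<₀ 0<½ (∙-monoʳ-< x x<y))

  ½·[x+y]<₀y : ∀ {x y} → x <₀ y → ½ · (x +ᴳ y) <₀ y
  ½·[x+y]<₀y {x} {y} x<y = subst (½ · (x +ᴳ y) <₀_) (½·[x+x]≡x y) (·-monoʳ-<₀ 0<½ (<₀-+-mono y x<y))

  -- Quantifier elimination

  Form : ℕ → Set
  Form = Vector C

  infixl 6 _⊕_ _⊝_
  infixr 9 _⊛_
  infix 9 ⊖_
  infix 8 _⊙_

  _⊕_ : ∀ {n} → Form n → Form n → Form n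
  _⊕_ = zipWith _+_

  _⊛_ : ∀ {n} → C → Form n → Form n
  c ⊛ a = mapᵛ (c *_) a

  ⊖_ : ∀ {n} → Form n → Form n
  ⊖ a = (- 1#) ⊛ a

  _⊝_ : ∀ {n} → Form n → Form n → Form n
  a ⊝ b = a ⊕ ⊖ b

  basis : ∀ {n} → Fin n → Form n
  basis zero = 1# ∷ᵛ replicate _ 0#
  basis (suc i) = 0# ∷ᵛ basis i

  _⊙_ : ∀ {n} → Form n → Vector G n → G
  _⊙_ {zero} a g = 0ᴳ
  _⊙_ {suc n} a g = head a · head g +ᴳ tail a ⊙ tail g

  ⊙-⊕ : ∀ {n} (a b : Form n) g → (a ⊕ b) ⊙ g ≡ a ⊙ g +ᴳ b ⊙ g
  ⊙-⊕ {zero} a b g = sym (+ᴹ-identityˡ 0ᴳ)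
  ⊙-⊕ {suc n} a b g = begin
    (head a + head b) · head g +ᴳ (tail a ⊕ tail b) ⊙ tail g
      ≡⟨ cong₂ _+ᴳ_ (*ₗ-distribʳ (head g) (head a) (head b)) (⊙-⊕ (tail a) (tail b) (tail g)) ⟩
    (head a · head g +ᴳ head b · head g) +ᴳ (tail a ⊙ tail g +ᴳ tail b ⊙ tail g)
      ≡⟨ interchange _ _ _ _ ⟩
    a ⊙ g +ᴳ b ⊙ g ∎
    where open ≡-Reasoning

  ⊙-⊛ : ∀ {n} c (a : Form n) g → (c ⊛ a) ⊙ g ≡ c · a ⊙ g
  ⊙-⊛ {zero} c a g = sym (*ₗ-zeroʳ c)
  ⊙-⊛ {suc n} c a g = begin
    (c * head a) · head g +ᴳ (c ⊛ tail a) ⊙ tail g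
      ≡⟨ cong₂ _+ᴳ_ (*ₗ-assoc c (head a) (head g)) (⊙-⊛ c (tail a) (tail g)) ⟩
    c · (head a · head g) +ᴳ c · (tail a ⊙ tail g)  ≡⟨ *ₗ-distribˡ c _ _ ⟨
    c · a ⊙ g                                        ∎
    where open ≡-Reasoning

  ⊙-⊖ : ∀ {n} (a : Form n) g → (⊖ a) ⊙ g ≡ -ᴳ (a ⊙ g)
  ⊙-⊖ a g = trans (⊙-⊛ (- 1#) a g) (-1·x≡-x (a ⊙ g))

  ⊙-⊝ : ∀ {n} (a b : Form n) g → (a ⊝ b) ⊙ g ≡ a ⊙ g +ᴳ -ᴳ (b ⊙ g)
  ⊙-⊝ a b g = trans (⊙-⊕ a (⊖ b) g) (cong (a ⊙ g +ᴳ_) (⊙-⊖ b g))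

  ⊙-zero : ∀ {n} (g : Vector G n) → replicate n 0# ⊙ g ≡ 0ᴳ
  ⊙-zero {zero} g = refl
  ⊙-zero {suc n} g = trans (cong₂ _+ᴳ_ (*ₗ-zeroˡ (head g)) (⊙-zero (tail g))) (+ᴹ-identityˡ 0ᴳ)

  ⊙-basis : ∀ {n} (i : Fin n) g → basis i ⊙ g ≡ g i
  ⊙-basis zero g = trans (cong₂ _+ᴳ_ (*ₗ-identityˡ (head g)) (⊙-zero (tail g))) (+ᴹ-identityʳ (head g))
  ⊙-basis (suc i) g = trans (cong₂ _+ᴳ_ (*ₗ-zeroˡ (head g)) (⊙-basis i (tail g))) (+ᴹ-identityˡ _)

  linearise : ∀ {n} → TermOVS C n → Form n
  linearise (var i) = basis i
  linearise (add s t) = linearise s ⊕ linearise t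
  linearise (scal c t) = c ⊛ linearise t

  data Lit (n : ℕ) : Set where
    _≈0 _>0 : Form n → Lit n

  Conj DNF : ℕ → Set
  Conj n = List (Lit n)
  DNF n = List (Conj n)

  ⟦_⟧ˡ : ∀ {n} → Lit n → Vector G n → Set
  ⟦ a ≈0 ⟧ˡ g = a ⊙ g ≡ 0ᴳ
  ⟦ a >0 ⟧ˡ g = 0ᴳ <₀ a ⊙ g

  ⟦_⟧ᶜ : ∀ {n} → Conj n → Vector G n → Set
  ⟦ c ⟧ᶜ g = All (λ l → ⟦ l ⟧ˡ g) c

  ⟦_⟧ᵈ : ∀ {n} → DNF n → Vector G n → Set
  ⟦ d ⟧ᵈ g = Any (λ c → ⟦ c ⟧ᶜ g) d

  ⟦⊝≈0⟧ : ∀ {n} (a b : Form n) g → ⟦ (a ⊝ b) ≈0 ⟧ˡ g ⇔ a ⊙ g ≡ b ⊙ g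
  ⟦⊝≈0⟧ a b g = mk⇔
    (λ a-b≡0 → x∙y⁻¹≈ε⇒x≈y (a ⊙ g) (b ⊙ g) (trans (sym (⊙-⊝ a b g)) a-b≡0))
    (λ a≡b → trans (⊙-⊝ a b g) (x≈y⇒x∙y⁻¹≈ε a≡b))

  ⟦⊝>0⟧ : ∀ {n} (a b : Form n) g → ⟦ (a ⊝ b) >0 ⟧ˡ g ⇔ b ⊙ g <₀ a ⊙ g
  ⟦⊝>0⟧ a b g = ⇔.trans
    (mk⇔ (subst (0ᴳ <₀_) (⊙-⊝ a b g)) (subst (0ᴳ <₀_) (sym (⊙-⊝ a b g)))) ε<x∙y⁻¹⇔y<x

  literal : ∀ {n} → Lit n → DNF n
  literal l = (l ∷ []) ∷ []

  ⟦literal⟧ : ∀ {n} (l : Lit n) g → ⟦ literal l ⟧ᵈ g ⇔ ⟦ l ⟧ˡ g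
  ⟦literal⟧ l g = mk⇔ (λ { (here (p ∷ [])) → p }) (λ p → here (p ∷ []))

  infixr 7 _∧ᵈ_

  _∧ᵈ_ : ∀ {n} → DNF n → DNF n → DNF n
  _∧ᵈ_ = cartesianProductWith _++_

  ⟦∧ᵈ⟧ : ∀ {n} (d e : DNF n) g → ⟦ d ∧ᵈ e ⟧ᵈ g ⇔ (⟦ d ⟧ᵈ g × ⟦ e ⟧ᵈ g)
  ⟦∧ᵈ⟧ d e g = mk⇔
    (Any.cartesianProductWith⁻ _++_ (λ {c} → All.++⁻ c) d e)
    (uncurry (Any.cartesianProductWith⁺ _++_ All.++⁺))

  ⋀ : ∀ {n} → List (DNF n) → DNF n
  ⋀ = foldr _∧ᵈ_ ([] ∷ [])

  ⟦⋀⟧ : ∀ {n} (ds : List (DNF n)) g → ⟦ ⋀ ds ⟧ᵈ g ⇔ All (λ d → ⟦ d ⟧ᵈ g) ds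
  ⟦⋀⟧ [] g = mk⇔ (λ _ → []) (λ _ → here [])
  ⟦⋀⟧ (d ∷ ds) g = begin
    ⟦ d ∧ᵈ ⋀ ds ⟧ᵈ g               ≈⟨ ⟦∧ᵈ⟧ d (⋀ ds) g ⟩
    (⟦ d ⟧ᵈ g × ⟦ ⋀ ds ⟧ᵈ g)        ≈⟨ ⇔.refl ×-⇔ ⟦⋀⟧ ds g ⟩
    (⟦ d ⟧ᵈ g × All (λ d → ⟦ d ⟧ᵈ g) ds)  ≈⟨ All-∷ ⟨
    All (λ d → ⟦ d ⟧ᵈ g) (d ∷ ds)   ∎
    where open ⇔-Reasoning

  ⟦++⟧ : ∀ {n} (d e : DNF n) g → ⟦ d ++ e ⟧ᵈ g ⇔ (⟦ d ⟧ᵈ g ⊎ ⟦ e ⟧ᵈ g)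
  ⟦++⟧ d e g = Any-++

  ¬ˡ : ∀ {n} → Lit n → DNF n
  ¬ˡ (a ≈0) = literal (a >0) ++ literal ((⊖ a) >0)
  ¬ˡ (a >0) = literal (a ≈0) ++ literal ((⊖ a) >0)

  ⟦¬ˡ⟧ : ∀ {n} (l : Lit n) g → ⟦ ¬ˡ l ⟧ᵈ g ⇔ (¬ ⟦ l ⟧ˡ g)
  ⟦¬ˡ⟧ (a ≈0) g = begin
    ⟦ literal (a >0) ++ literal ((⊖ a) >0) ⟧ᵈ g  ≈⟨ ⟦++⟧ (literal (a >0)) _ g ⟩
    (_ ⊎ _)                                     ≈⟨ ⟦literal⟧ (a >0) g ⊎-⇔ ⟦literal⟧ ((⊖ a) >0) g ⟩
    (0ᴳ <₀ a ⊙ g ⊎ 0ᴳ <₀ (⊖ a) ⊙ g)            ≡⟨ cong (λ y → 0ᴳ <₀ a ⊙ g ⊎ 0ᴳ <₀ y) (⊙-⊖ a g) ⟩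
    (0ᴳ <₀ a ⊙ g ⊎ 0ᴳ <₀ -ᴳ (a ⊙ g))          ≈⟨ ⇔.refl ⊎-⇔ ε<x⁻¹⇔x<ε ⟩
    (0ᴳ <₀ a ⊙ g ⊎ a ⊙ g <₀ 0ᴳ)               ≈⟨ x≢ε⇔ ⟨
    a ⊙ g ≢ 0ᴳ                                 ∎
    where open ⇔-Reasoning
  ⟦¬ˡ⟧ (a >0) g = begin
    ⟦ literal (a ≈0) ++ literal ((⊖ a) >0) ⟧ᵈ g  ≈⟨ ⟦++⟧ (literal (a ≈0)) _ g ⟩
    (_ ⊎ _)                                     ≈⟨ ⟦literal⟧ (a ≈0) g ⊎-⇔ ⟦literal⟧ ((⊖ a) >0) g ⟩
    (a ⊙ g ≡ 0ᴳ ⊎ 0ᴳ <₀ (⊖ a) ⊙ g)             ≡⟨ cong (λ y → a ⊙ g ≡ 0ᴳ ⊎ 0ᴳ <₀ y) (⊙-⊖ a g) ⟩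
    (a ⊙ g ≡ 0ᴳ ⊎ 0ᴳ <₀ -ᴳ (a ⊙ g))           ≈⟨ ⇔.refl ⊎-⇔ ε<x⁻¹⇔x<ε ⟩
    (a ⊙ g ≡ 0ᴳ ⊎ a ⊙ g <₀ 0ᴳ)                ≈⟨ ε≮x⇔ ⟨
    (¬ 0ᴳ <₀ a ⊙ g)                           ∎
    where open ⇔-Reasoning

  ¬ᶜ : ∀ {n} → Conj n → DNF n
  ¬ᶜ = concatMap ¬ˡ

  ¬ᵈ : ∀ {n} → DNF n → DNF n
  ¬ᵈ d = ⋀ (map ¬ᶜ d)

  module _ (em : ExcludedMiddle 0ℓ) where
    open Logic.Classical em

    ⟦¬ᶜ⟧ : ∀ {n} (c : Conj n) g → ⟦ ¬ᶜ c ⟧ᵈ g ⇔ (¬ ⟦ c ⟧ᶜ g)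
    ⟦¬ᶜ⟧ c g = begin
      ⟦ concatMap ¬ˡ c ⟧ᵈ g                ≈⟨ mk⇔ (Any.concatMap⁻ ¬ˡ) (Any.concatMap⁺ ¬ˡ) ⟩
      Any (λ l → ⟦ ¬ˡ l ⟧ᵈ g) c            ≈⟨ Any-cong (λ {l} → ⟦¬ˡ⟧ l g) ⟩
      Any (λ l → ¬ ⟦ l ⟧ˡ g) c             ≈⟨ ¬All⇔Any¬ ⟨
      (¬ ⟦ c ⟧ᶜ g)                         ∎
      where open ⇔-Reasoning

    ⟦¬ᵈ⟧ : ∀ {n} (d : DNF n) g → ⟦ ¬ᵈ d ⟧ᵈ g ⇔ (¬ ⟦ d ⟧ᵈ g)
    ⟦¬ᵈ⟧ d g = begin
      ⟦ ⋀ (map ¬ᶜ d) ⟧ᵈ g                 ≈⟨ ⟦⋀⟧ (map ¬ᶜ d) g ⟩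
      All (λ e → ⟦ e ⟧ᵈ g) (map ¬ᶜ d)     ≈⟨ All-map ⟩
      All (λ c → ⟦ ¬ᶜ c ⟧ᵈ g) d           ≈⟨ All-cong (λ {c} → ⟦¬ᶜ⟧ c g) ⟩
      All (λ c → ¬ ⟦ c ⟧ᶜ g) d            ≈⟨ ¬Any⇔All¬ ⟨
      (¬ ⟦ d ⟧ᵈ g)                        ∎
      where open ⇔-Reasoning

  data Solved (n : ℕ) : Set where
    indep : Lit n → Solved n
    x≈_ _<x x<_ : Form n → Solved n

  ⟦_⟧ˢ : ∀ {n} → Solved n → G → Vector G n → Set
  ⟦ indep l ⟧ˢ x g = ⟦ l ⟧ˡ g
  ⟦ x≈ b ⟧ˢ x g = x ≡ b ⊙ g
  ⟦ b <x ⟧ˢ x g = b ⊙ g <₀ x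
  ⟦ x< b ⟧ˢ x g = x <₀ b ⊙ g

  root : ∀ {n} (a : Form (suc n)) → head a ≢ 0# → Form n
  root a a₀≢0 = (- proj₁ (inverse (head a) a₀≢0)) ⊛ tail a

  ⊙-root : ∀ {n} (a : Form (suc n)) (a₀≢0 : head a ≢ 0#) g →
           a ⊙ g ≡ head a · (head g +ᴳ -ᴳ (root a a₀≢0 ⊙ tail g))
  ⊙-root a a₀≢0 g with inverse (head a) a₀≢0
  ... | a₀⁻¹ , a₀a₀⁻¹≡1 = sym (begin
    a₀ · (head g +ᴳ -ᴳ ((- a₀⁻¹) ⊛ tail a ⊙ tail g))  ≡⟨ *ₗ-distribˡ a₀ _ _ ⟩
    a₀ · head g +ᴳ a₀ · -ᴳ ((- a₀⁻¹) ⊛ tail a ⊙ tail g)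
      ≡⟨ cong (λ y → a₀ · head g +ᴳ a₀ · -ᴳ y) (trans (⊙-⊛ (- a₀⁻¹) (tail a) (tail g)) (neg-· a₀⁻¹ _)) ⟩
    a₀ · head g +ᴳ a₀ · -ᴳ -ᴳ (a₀⁻¹ · tail a ⊙ tail g)  ≡⟨ cong (λ y → a₀ · head g +ᴳ a₀ · y) (-ᴳ-involutive _) ⟩
    a₀ · head g +ᴳ a₀ · a₀⁻¹ · tail a ⊙ tail g         ≡⟨ cong (a₀ · head g +ᴳ_) (*ₗ-assoc a₀ a₀⁻¹ _) ⟨
    a₀ · head g +ᴳ (a₀ * a₀⁻¹) · tail a ⊙ tail g       ≡⟨ cong (λ c → a₀ · head g +ᴳ c · tail a ⊙ tail g) a₀a₀⁻¹≡1 ⟩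
    a₀ · head g +ᴳ 1# · tail a ⊙ tail g                ≡⟨ cong (a₀ · head g +ᴳ_) (*ₗ-identityˡ _) ⟩
    a ⊙ g                                              ∎)
    where
    open ≡-Reasoning
    a₀ : C
    a₀ = head a

  ⊙-indep : ∀ {n} (a : Form (suc n)) → head a ≡ 0# → ∀ g → a ⊙ g ≡ tail a ⊙ tail g
  ⊙-indep a a₀≡0 g = trans (cong (λ c → c · head g +ᴳ tail a ⊙ tail g) a₀≡0)
                           (trans (cong (_+ᴳ tail a ⊙ tail g) (*ₗ-zeroˡ (head g))) (+ᴹ-identityˡ _))

  solve : ∀ {n} → Lit (suc n) → Solved n
  solve (a ≈0) with head a C≟ 0#
  ... | yes _ = indep (tail a ≈0)
  ... | no a₀≢0 = x≈ root a a₀≢0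
  solve (a >0) with C-compare 0# (head a)
  ... | tri< 0<a₀ _ _ = root a (0<x⇒x≢0 0<a₀) <x
  ... | tri≈ _ _ _ = indep (tail a >0)
  ... | tri> _ _ a₀<0 = x< root a (x<0⇒x≢0 a₀<0)

  ⟦solve⟧ : ∀ {n} (l : Lit (suc n)) g → ⟦ l ⟧ˡ g ⇔ ⟦ solve l ⟧ˢ (head g) (tail g)
  ⟦solve⟧ {n} (a ≈0) g with head a C≟ 0#
  ... | yes a₀≡0 = ≡⇒⇔ (cong (_≡ 0ᴳ) (⊙-indep a a₀≡0 g))
  ... | no a₀≢0 = begin
    a ⊙ g ≡ 0ᴳ                                     ≡⟨ cong (_≡ 0ᴳ) (⊙-root a a₀≢0 g) ⟩
    head a · (head g +ᴳ -ᴳ (b ⊙ tail g)) ≡ 0ᴳ      ≈⟨ c·y≡0⇔y≡0 a₀≢0 ⟩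
    head g +ᴳ -ᴳ (b ⊙ tail g) ≡ 0ᴳ                 ≈⟨ mk⇔ (x∙y⁻¹≈ε⇒x≈y _ _) x≈y⇒x∙y⁻¹≈ε ⟩
    head g ≡ b ⊙ tail g                            ∎
    where
    open ⇔-Reasoning
    b : Form n
    b = root a a₀≢0
  ⟦solve⟧ {n} (a >0) g with C-compare 0# (head a)
  ... | tri< 0<a₀ _ _ = begin
    0ᴳ <₀ a ⊙ g                                    ≡⟨ cong (0ᴳ <₀_) (⊙-root a _ g) ⟩
    0ᴳ <₀ head a · (head g +ᴳ -ᴳ (b ⊙ tail g))     ≈⟨ 0<₀c·y⇔0<₀y 0<a₀ ⟩
    0ᴳ <₀ head g +ᴳ -ᴳ (b ⊙ tail g)                ≈⟨ ε<x∙y⁻¹⇔y<x ⟩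
    b ⊙ tail g <₀ head g                           ∎
    where
    open ⇔-Reasoning
    b : Form n
    b = root a (0<x⇒x≢0 0<a₀)
  ... | tri≈ _ 0≡a₀ _ = ≡⇒⇔ (cong (0ᴳ <₀_) (⊙-indep a (sym 0≡a₀) g))
  ... | tri> _ _ a₀<0 = begin
    0ᴳ <₀ a ⊙ g                                    ≡⟨ cong (0ᴳ <₀_) (⊙-root a _ g) ⟩
    0ᴳ <₀ head a · (head g +ᴳ -ᴳ (b ⊙ tail g))     ≈⟨ 0<₀c·y⇔y<₀0 a₀<0 ⟩
    head g +ᴳ -ᴳ (b ⊙ tail g) <₀ 0ᴳ                ≈⟨ x∙y⁻¹<ε⇔x<y ⟩
    head g <₀ b ⊙ tail g                           ∎
    where
    open ⇔-Reasoning
    b : Form n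
    b = root a (x<0⇒x≢0 a₀<0)

  record Cell (n : ℕ) : Set where
    constructor cell
    field
      others : Conj n
      roots lowers uppers : List (Form n)

  ⟦_⟧ᵏ : ∀ {n} → Cell n → G → Vector G n → Set
  ⟦ cell c rs ls us ⟧ᵏ x g =
    ⟦ c ⟧ᶜ g × All (λ r → x ≡ r ⊙ g) rs × All (λ l → l ⊙ g <₀ x) ls × All (λ u → x <₀ u ⊙ g) us

  insert : ∀ {n} → Solved n → Cell n → Cell n
  insert (indep l) (cell c rs ls us) = cell (l ∷ c) rs ls us
  insert (x≈ r) (cell c rs ls us) = cell c (r ∷ rs) ls us
  insert (l <x) (cell c rs ls us) = cell c rs (l ∷ ls) us
  insert (x< u) (cell c rs ls us) = cell c rs ls (u ∷ us)

  ⟦insert⟧ : ∀ {n} (s : Solved n) k x g → (⟦ s ⟧ˢ x g × ⟦ k ⟧ᵏ x g) ⇔ ⟦ insert s k ⟧ᵏ x g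
  ⟦insert⟧ (indep _) (cell _ _ _ _) _ _ = mk⇔
    (λ (p , c , r , l , u) → p ∷ c , r , l , u) (λ { (p ∷ c , r , l , u) → p , c , r , l , u })
  ⟦insert⟧ (x≈ _) (cell _ _ _ _) _ _ = mk⇔
    (λ (p , c , r , l , u) → c , p ∷ r , l , u) (λ { (c , p ∷ r , l , u) → p , c , r , l , u })
  ⟦insert⟧ (_ <x) (cell _ _ _ _) _ _ = mk⇔
    (λ (p , c , r , l , u) → c , r , p ∷ l , u) (λ { (c , r , p ∷ l , u) → p , c , r , l , u })
  ⟦insert⟧ (x< _) (cell _ _ _ _) _ _ = mk⇔
    (λ (p , c , r , l , u) → c , r , l , p ∷ u) (λ { (c , r , l , p ∷ u) → p , c , r , l , u })

  classify : ∀ {n} → List (Solved n) → Cell n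
  classify = foldr insert (cell [] [] [] [])

  ⟦classify⟧ : ∀ {n} (ss : List (Solved n)) x g → All (λ s → ⟦ s ⟧ˢ x g) ss ⇔ ⟦ classify ss ⟧ᵏ x g
  ⟦classify⟧ [] x g = mk⇔ (λ _ → [] , [] , [] , []) (λ _ → [])
  ⟦classify⟧ (s ∷ ss) x g = begin
    All (λ s → ⟦ s ⟧ˢ x g) (s ∷ ss)                 ≈⟨ All-∷ ⟩
    (⟦ s ⟧ˢ x g × All (λ s → ⟦ s ⟧ˢ x g) ss)        ≈⟨ ⇔.refl ×-⇔ ⟦classify⟧ ss x g ⟩
    (⟦ s ⟧ˢ x g × ⟦ classify ss ⟧ᵏ x g)             ≈⟨ ⟦insert⟧ s (classify ss) x g ⟩
    ⟦ insert s (classify ss) ⟧ᵏ x g                 ∎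
    where open ⇔-Reasoning

  substitute : ∀ {n} → Form n → Cell n → Conj n
  substitute b (cell c rs ls us) =
    c ++ map (λ r → (b ⊝ r) ≈0) rs ++ map (λ l → (b ⊝ l) >0) ls ++ map (λ u → (u ⊝ b) >0) us

  ⟦substitute⟧ : ∀ {n} (b : Form n) k g → ⟦ substitute b k ⟧ᶜ g ⇔ ⟦ k ⟧ᵏ (b ⊙ g) g
  ⟦substitute⟧ b (cell c rs ls us) g =
    ⇔.trans All-++ (⇔.refl ×-⇔ ⇔.trans All-++ (roots ×-⇔ ⇔.trans All-++ (lowers ×-⇔ uppers)))
    where
    roots : ⟦ map (λ r → (b ⊝ r) ≈0) rs ⟧ᶜ g ⇔ All (λ r → b ⊙ g ≡ r ⊙ g) rs
    roots = ⇔.trans All-map (All-cong (λ {r} → ⟦⊝≈0⟧ b r g))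
    lowers : ⟦ map (λ l → (b ⊝ l) >0) ls ⟧ᶜ g ⇔ All (λ l → l ⊙ g <₀ b ⊙ g) ls
    lowers = ⇔.trans All-map (All-cong (λ {l} → ⟦⊝>0⟧ b l g))
    uppers : ⟦ map (λ u → (u ⊝ b) >0) us ⟧ᶜ g ⇔ All (λ u → b ⊙ g <₀ u ⊙ g) us
    uppers = ⇔.trans All-map (All-cong (λ {u} → ⟦⊝>0⟧ u b g))

  separate : ∀ {n} → List (Form n) → List (Form n) → Conj n
  separate ls us = concatMap (λ l → map (λ u → (u ⊝ l) >0) us) ls

  ⟦separate⟧ : ∀ {n} (ls us : List (Form n)) g →
               ⟦ separate ls us ⟧ᶜ g ⇔ All (λ l → All (λ u → l ⊙ g <₀ u ⊙ g) us) ls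
  ⟦separate⟧ ls us g = begin
    ⟦ concatMap (λ l → map (λ u → (u ⊝ l) >0) us) ls ⟧ᶜ g
      ≈⟨ mk⇔ All.concat⁻ All.concat⁺ ⟩
    All (All (λ l → ⟦ l ⟧ˡ g)) (map (λ l → map (λ u → (u ⊝ l) >0) us) ls)
      ≈⟨ All-map ⟩
    All (λ l → ⟦ map (λ u → (u ⊝ l) >0) us ⟧ᶜ g) ls
      ≈⟨ All-cong (⇔.trans All-map (All-cong (λ {u} → ⟦⊝>0⟧ u _ g))) ⟩
    All (λ l → All (λ u → l ⊙ g <₀ u ⊙ g) us) ls  ∎
    where open ⇔-Reasoning

  eliminate : ∀ {n} → Cell n → Conj n
  eliminate (cell c [] ls us) = c ++ separate ls us
  eliminate k@(cell _ (r ∷ _) _ _) = substitute r k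

  ∃ᶜ : ∀ {n} → Conj (suc n) → Conj n
  ∃ᶜ c = eliminate (classify (map solve c))

  ∃ᵈ : ∀ {n} → DNF (suc n) → DNF n
  ∃ᵈ = map ∃ᶜ

  qe : ∀ {n} → Fm (AtomOVS C) n → DNF n
  qe (atom (s ≐ t)) = literal ((linearise s ⊝ linearise t) ≈0)
  qe (atom (s <₀′ t)) = literal ((linearise t ⊝ linearise s) >0)
  qe ⊥′ = []
  qe (φ ⇒ ψ) = ¬ᵈ (qe φ) ++ qe ψ
  qe (φ ∧′ ψ) = qe φ ∧ᵈ qe ψ
  qe (φ ∨′ ψ) = qe φ ++ qe ψ
  qe (∀′ φ) = ¬ᵈ (∃ᵈ (¬ᵈ (qe φ)))
  qe (∃′ φ) = ∃ᵈ (qe φ)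

  totalOrder : TotalOrder 0ℓ 0ℓ 0ℓ
  totalOrder = record
    { isTotalOrder = StrictToNonStrict.isTotalOrder _≡_ _<₀_ <₀-isStrictTotalOrder }

  open TotalOrder totalOrder using () renaming (_≤_ to _≤₀_)
  open Extrema totalOrder using (argmax; argmin; f[⊥]≤f[argmax]; f[xs]≤f[argmax];
    f[argmin]≤f[⊤]; f[argmin]≤f[xs]; argmax-all; argmin-all)

  ≤₀-<₀-trans : ∀ {x y z} → x ≤₀ y → y <₀ z → x <₀ z
  ≤₀-<₀-trans (inj₁ x<y) y<z = <₀-trans x<y y<z
  ≤₀-<₀-trans (inj₂ refl) y<z = y<z

  <₀-≤₀-trans : ∀ {x y z} → x <₀ y → y ≤₀ z → x <₀ z
  <₀-≤₀-trans x<y (inj₁ y<z) = <₀-trans x<y y<z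
  <₀-≤₀-trans x<y (inj₂ refl) = x<y

  -- D is an ordered vector space embedded in G with a positive element p: either G itself, or a
  -- nonzero subspace given as a type of pairs.
  module Embedded {D : Set} (_⊞_ : D → D → D) (_⊡_ : C → D → D) (emb : D → G)
    (emb-⊞ : ∀ x y → emb (x ⊞ y) ≡ emb x +ᴳ emb y)
    (emb-⊡ : ∀ c x → emb (c ⊡ x) ≡ c · emb x)
    (p : D) (0<p : 0ᴳ <₀ emb p)
    where

    _⊙ᴰ_ : ∀ {n} → Form n → Vector D n → D
    _⊙ᴰ_ {zero} a ρ = 0# ⊡ p
    _⊙ᴰ_ {suc n} a ρ = (head a ⊡ head ρ) ⊞ (tail a ⊙ᴰ tail ρ)

    emb-⊙ᴰ : ∀ {n} (a : Form n) ρ → emb (a ⊙ᴰ ρ) ≡ a ⊙ (emb ∘ ρ)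
    emb-⊙ᴰ {zero} a ρ = trans (emb-⊡ 0# p) (*ₗ-zeroˡ (emb p))
    emb-⊙ᴰ {suc n} a ρ = trans (emb-⊞ _ _) (cong₂ _+ᴳ_ (emb-⊡ (head a) (head ρ)) (emb-⊙ᴰ (tail a) (tail ρ)))

    emb-evalV : ∀ {n} (t : TermOVS C n) ρ → emb (evalV _⊞_ _⊡_ emb t ρ) ≡ linearise t ⊙ (emb ∘ ρ)
    emb-evalV (var i) ρ = sym (⊙-basis i (emb ∘ ρ))
    emb-evalV (add s t) ρ = trans (emb-⊞ _ _)
      (trans (cong₂ _+ᴳ_ (emb-evalV s ρ) (emb-evalV t ρ)) (sym (⊙-⊕ (linearise s) (linearise t) (emb ∘ ρ))))
    emb-evalV (scal c t) ρ = trans (emb-⊡ c _)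
      (trans (cong (c ·_) (emb-evalV t ρ)) (sym (⊙-⊛ c (linearise t) (emb ∘ ρ))))

    below-argmax : ∀ {x} l ls → emb (argmax emb l ls) <₀ emb x → All (λ y → emb y <₀ emb x) (l ∷ ls)
    below-argmax l ls m<x = ≤₀-<₀-trans (f[⊥]≤f[argmax] {f = emb} l ls) m<x
                          ∷ All.map (λ y≤m → ≤₀-<₀-trans y≤m m<x) (f[xs]≤f[argmax] {f = emb} l ls)

    above-argmin : ∀ {x} u us → emb x <₀ emb (argmin emb u us) → All (λ y → emb x <₀ emb y) (u ∷ us)
    above-argmin u us x<m = <₀-≤₀-trans x<m (f[argmin]≤f[⊤] {f = emb} u us)
                          ∷ All.map (λ m≤y → <₀-≤₀-trans x<m m≤y) (f[argmin]≤f[xs] {f = emb} u us)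

    interpolate : (ls us : List D) → All (λ l → All (λ u → emb l <₀ emb u) us) ls →
                  Σ[ x ∈ D ] (All (λ l → emb l <₀ emb x) ls × All (λ u → emb x <₀ emb u) us)
    interpolate [] [] _ = p , [] , []
    interpolate (l ∷ ls) [] _ = m ⊞ p , below-argmax l ls m<m+p , []
      where
      m : D
      m = argmax emb l ls
      m<m+p : emb m <₀ emb (m ⊞ p)
      m<m+p = subst (emb m <₀_) (sym (emb-⊞ m p)) (x<x∙y (emb m) 0<p)
    interpolate [] (u ∷ us) _ = M ⊞ ((- 1#) ⊡ p) , [] , above-argmin u us M-p<M
      where
      M : D
      M = argmin emb u us
      M-p<M : emb (M ⊞ ((- 1#) ⊡ p)) <₀ emb M
      M-p<M = subst (_<₀ emb M)
        (sym (trans (emb-⊞ M _) (cong (emb M +ᴳ_) (trans (emb-⊡ (- 1#) p) (-1·x≡-x (emb p))))))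
        (x∙y<x (emb M) (Equivalence.to ε<x⁻¹⇔x<ε (subst (0ᴳ <₀_) (sym (-ᴳ-involutive (emb p))) 0<p)))
    interpolate (l ∷ ls) (u ∷ us) ls<us = ½ ⊡ (m ⊞ M) ,
      below-argmax l ls (subst (emb m <₀_) (sym midpoint) (x<₀½·[x+y] m<M)) ,
      above-argmin u us (subst (_<₀ emb M) (sym midpoint) (½·[x+y]<₀y m<M))
      where
      m M : D
      m = argmax emb l ls
      M = argmin emb u us
      below-M : ∀ {y} → All (λ u → emb y <₀ emb u) (u ∷ us) → emb y <₀ emb M
      below-M (y<u ∷ y<us) = argmin-all emb y<u y<us
      m<M : emb m <₀ emb M
      m<M = argmax-all emb (below-M (All.head ls<us)) (All.map below-M (All.tail ls<us))
      midpoint : emb (½ ⊡ (m ⊞ M)) ≡ ½ · (emb m +ᴳ emb M)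
      midpoint = trans (emb-⊡ ½ _) (cong (½ ·_) (emb-⊞ m M))

    All-⊙ᴰ : ∀ {n} (P : G → Set) (bs : List (Form n)) ρ →
             All (λ b → P (b ⊙ (emb ∘ ρ))) bs ⇔ All (λ y → P (emb y)) (map (_⊙ᴰ ρ) bs)
    All-⊙ᴰ P bs ρ = ⇔.trans
      (All-cong (λ {b} → ≡⇒⇔ (cong P (sym (emb-⊙ᴰ b ρ))))) (⇔.sym All-map)

    ⟦eliminate⟧ : ∀ {n} (k : Cell n) ρ → (Σ[ x ∈ D ] ⟦ k ⟧ᵏ (emb x) (emb ∘ ρ)) ⇔ ⟦ eliminate k ⟧ᶜ (emb ∘ ρ)
    ⟦eliminate⟧ k@(cell _ (r ∷ _) _ _) ρ = mk⇔
      (λ { (x , hk@(_ , x≡r ∷ _ , _)) →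
           Equivalence.from (⟦substitute⟧ r k (emb ∘ ρ)) (subst (λ y → ⟦ k ⟧ᵏ y (emb ∘ ρ)) x≡r hk) })
      (λ h → r ⊙ᴰ ρ , subst (λ y → ⟦ k ⟧ᵏ y (emb ∘ ρ)) (sym (emb-⊙ᴰ r ρ))
                              (Equivalence.to (⟦substitute⟧ r k (emb ∘ ρ)) h))
    ⟦eliminate⟧ (cell c [] ls us) ρ = mk⇔
      (λ { (x , hc , [] , hl , hu) → All.++⁺ hc (Equivalence.from (⟦separate⟧ ls us (emb ∘ ρ))
             (All.map (λ l<x → All.map (λ x<u → <₀-trans l<x x<u) hu) hl)) })
      from
      where
      separated : ⟦ separate ls us ⟧ᶜ (emb ∘ ρ) →
                  All (λ l → All (λ u → emb l <₀ emb u) (map (_⊙ᴰ ρ) us)) (map (_⊙ᴰ ρ) ls)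
      separated = All.map (λ {l} → Equivalence.to (All-⊙ᴰ (emb l <₀_) us ρ))
                ∘ Equivalence.to (All-⊙ᴰ (λ a → All (λ u → a <₀ u ⊙ (emb ∘ ρ)) us) ls ρ)
                ∘ Equivalence.to (⟦separate⟧ ls us (emb ∘ ρ))
      from : ⟦ c ++ separate ls us ⟧ᶜ (emb ∘ ρ) → Σ[ x ∈ D ] ⟦ cell c [] ls us ⟧ᵏ (emb x) (emb ∘ ρ)
      from h =
        let (hc , hsep) = All.++⁻ c h
            (x , hl , hu) = interpolate (map (_⊙ᴰ ρ) ls) (map (_⊙ᴰ ρ) us) (separated hsep)
        in x , hc , [] , Equivalence.from (All-⊙ᴰ (_<₀ emb x) ls ρ) hl
                       , Equivalence.from (All-⊙ᴰ (emb x <₀_) us ρ) hu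

    ⟦∃ᶜ⟧ : ∀ {n} (c : Conj (suc n)) ρ → (Σ[ x ∈ D ] ⟦ c ⟧ᶜ (emb ∘ (x ∷ᵛ ρ))) ⇔ ⟦ ∃ᶜ c ⟧ᶜ (emb ∘ ρ)
    ⟦∃ᶜ⟧ c ρ = ⇔.trans (Σ-cong (λ {x} → solved x)) (⟦eliminate⟧ _ ρ)
      where
      solved : ∀ x → ⟦ c ⟧ᶜ (emb ∘ (x ∷ᵛ ρ)) ⇔ ⟦ classify (map solve c) ⟧ᵏ (emb x) (emb ∘ ρ)
      solved x = begin
        ⟦ c ⟧ᶜ (emb ∘ (x ∷ᵛ ρ))                              ≈⟨ All-cong (λ {l} → ⟦solve⟧ l (emb ∘ (x ∷ᵛ ρ))) ⟩
        All (λ l → ⟦ solve l ⟧ˢ (emb x) (emb ∘ ρ)) c         ≈⟨ All-map ⟨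
        All (λ s → ⟦ s ⟧ˢ (emb x) (emb ∘ ρ)) (map solve c)   ≈⟨ ⟦classify⟧ (map solve c) (emb x) (emb ∘ ρ) ⟩
        ⟦ classify (map solve c) ⟧ᵏ (emb x) (emb ∘ ρ)        ∎
        where open ⇔-Reasoning

    ⟦∃ᵈ⟧ : ∀ {n} (d : DNF (suc n)) ρ → (Σ[ x ∈ D ] ⟦ d ⟧ᵈ (emb ∘ (x ∷ᵛ ρ))) ⇔ ⟦ ∃ᵈ d ⟧ᵈ (emb ∘ ρ)
    ⟦∃ᵈ⟧ d ρ = begin
      (Σ[ x ∈ D ] ⟦ d ⟧ᵈ (emb ∘ (x ∷ᵛ ρ)))                   ≈⟨ Σ-Any ⟩
      Any (λ c → Σ[ x ∈ D ] ⟦ c ⟧ᶜ (emb ∘ (x ∷ᵛ ρ))) d       ≈⟨ Any-cong (λ {c} → ⟦∃ᶜ⟧ c ρ) ⟩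
      Any (λ c → ⟦ ∃ᶜ c ⟧ᶜ (emb ∘ ρ)) d                      ≈⟨ Any-map ⟨
      ⟦ ∃ᵈ d ⟧ᵈ (emb ∘ ρ)                                    ∎
      where open ⇔-Reasoning

    module _ (em : ExcludedMiddle 0ℓ) where
      open Logic.Classical em

      ⟦qe⟧ : ∀ {n} (φ : Fm (AtomOVS C) n) ρ → Sat (atomV _⊞_ _⊡_ emb) φ ρ ⇔ ⟦ qe φ ⟧ᵈ (emb ∘ ρ)
      ⟦qe⟧ (atom (s ≐ t)) ρ = begin
        emb (evalV _⊞_ _⊡_ emb s ρ) ≡ emb (evalV _⊞_ _⊡_ emb t ρ)  ≡⟨ cong₂ _≡_ (emb-evalV s ρ) (emb-evalV t ρ) ⟩
        linearise s ⊙ (emb ∘ ρ) ≡ linearise t ⊙ (emb ∘ ρ)          ≈⟨ ⟦⊝≈0⟧ (linearise s) (linearise t) (emb ∘ ρ) ⟨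
        ⟦ (linearise s ⊝ linearise t) ≈0 ⟧ˡ (emb ∘ ρ)              ≈⟨ ⟦literal⟧ _ (emb ∘ ρ) ⟨
        ⟦ literal ((linearise s ⊝ linearise t) ≈0) ⟧ᵈ (emb ∘ ρ)    ∎
        where open ⇔-Reasoning
      ⟦qe⟧ (atom (s <₀′ t)) ρ = begin
        emb (evalV _⊞_ _⊡_ emb s ρ) <₀ emb (evalV _⊞_ _⊡_ emb t ρ)  ≡⟨ cong₂ _<₀_ (emb-evalV s ρ) (emb-evalV t ρ) ⟩
        linearise s ⊙ (emb ∘ ρ) <₀ linearise t ⊙ (emb ∘ ρ)          ≈⟨ ⟦⊝>0⟧ (linearise t) (linearise s) (emb ∘ ρ) ⟨
        ⟦ (linearise t ⊝ linearise s) >0 ⟧ˡ (emb ∘ ρ)               ≈⟨ ⟦literal⟧ _ (emb ∘ ρ) ⟨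
        ⟦ literal ((linearise t ⊝ linearise s) >0) ⟧ᵈ (emb ∘ ρ)     ∎
        where open ⇔-Reasoning
      ⟦qe⟧ ⊥′ ρ = mk⇔ (λ ()) (λ ())
      ⟦qe⟧ {n} (φ ⇒ ψ) ρ = begin
        (Sat _ φ ρ → Sat _ ψ ρ)                       ≈⟨ →-cong-⇔ (⟦qe⟧ φ ρ) (⟦qe⟧ ψ ρ) ⟩
        (⟦ qe φ ⟧ᵈ g → ⟦ qe ψ ⟧ᵈ g)                   ≈⟨ →⇔¬⊎ ⟩
        ((¬ ⟦ qe φ ⟧ᵈ g) ⊎ ⟦ qe ψ ⟧ᵈ g)               ≈⟨ ⟦¬ᵈ⟧ em (qe φ) g ⊎-⇔ ⇔.refl ⟨
        (⟦ ¬ᵈ (qe φ) ⟧ᵈ g ⊎ ⟦ qe ψ ⟧ᵈ g)             ≈⟨ ⟦++⟧ (¬ᵈ (qe φ)) (qe ψ) g ⟨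
        ⟦ ¬ᵈ (qe φ) ++ qe ψ ⟧ᵈ g                      ∎
        where
        open ⇔-Reasoning
        g : Vector G n
        g = emb ∘ ρ
      ⟦qe⟧ (φ ∧′ ψ) ρ = ⇔.trans (⟦qe⟧ φ ρ ×-⇔ ⟦qe⟧ ψ ρ)
                          (⇔.sym (⟦∧ᵈ⟧ (qe φ) (qe ψ) (emb ∘ ρ)))
      ⟦qe⟧ (φ ∨′ ψ) ρ = ⇔.trans (⟦qe⟧ φ ρ ⊎-⇔ ⟦qe⟧ ψ ρ)
                          (⇔.sym (⟦++⟧ (qe φ) (qe ψ) (emb ∘ ρ)))
      ⟦qe⟧ (∀′ φ) ρ = begin
        ((x : D) → Sat _ φ (x ∷ᵛ ρ))                          ≈⟨ Π⇔¬Σ¬ ⟩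
        (¬ (Σ[ x ∈ D ] ¬ Sat _ φ (x ∷ᵛ ρ)))                    ≈⟨ ¬-cong (Σ-cong (λ {x} → negated x)) ⟩
        (¬ (Σ[ x ∈ D ] ⟦ ¬ᵈ (qe φ) ⟧ᵈ (emb ∘ (x ∷ᵛ ρ))))       ≈⟨ ¬-cong (⟦∃ᵈ⟧ (¬ᵈ (qe φ)) ρ) ⟩
        (¬ ⟦ ∃ᵈ (¬ᵈ (qe φ)) ⟧ᵈ (emb ∘ ρ))                      ≈⟨ ⟦¬ᵈ⟧ em (∃ᵈ (¬ᵈ (qe φ))) (emb ∘ ρ) ⟨
        ⟦ ¬ᵈ (∃ᵈ (¬ᵈ (qe φ))) ⟧ᵈ (emb ∘ ρ)                     ∎
        where
        open ⇔-Reasoning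
        negated : ∀ x → (¬ Sat _ φ (x ∷ᵛ ρ)) ⇔ ⟦ ¬ᵈ (qe φ) ⟧ᵈ (emb ∘ (x ∷ᵛ ρ))
        negated x = ⇔.trans (¬-cong (⟦qe⟧ φ (x ∷ᵛ ρ)))
                      (⇔.sym (⟦¬ᵈ⟧ em (qe φ) (emb ∘ (x ∷ᵛ ρ))))
      ⟦qe⟧ (∃′ φ) ρ = ⇔.trans (Σ-cong (λ {x} → ⟦qe⟧ φ (x ∷ᵛ ρ))) (⟦∃ᵈ⟧ (qe φ) ρ)

  subspace-elementary : ExcludedMiddle 0ℓ → (S : G → Set) →
    (∀ {a b} → S a → S b → S (a +ᴳ b)) → (∀ c {a} → S a → S (c · a)) →
    ∀ {z} → S z → 0ᴳ <₀ z → ElementarySubstructure S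
  subspace-elementary em S S-+ S-· {z} Sz 0<z = record
    { nonempty = z , Sz
    ; closed-+ = S-+
    ; closed-· = S-·
    ; elementary = λ φ ρ → ⇔.trans
        (Embedded.⟦qe⟧ _ _ proj₁ (λ _ _ → refl) (λ _ _ → refl) (z , Sz) 0<z em φ ρ)
        (⇔.sym
          (Embedded.⟦qe⟧ _+ᴳ_ _·_ (λ x → x) (λ _ _ → refl) (λ _ _ → refl) z 0<z em φ (proj₁ ∘ ρ)))
    }

  -- The valuation

  infix 4 _<ᵛ_ _≤ᵛ_
  _<ᵛ_ _≤ᵛ_ : Rel (Maybe G) 0ℓ
  _<ᵛ_ = _<∞_ _<₀_
  _≤ᵛ_ = _≤∞_ _<₀_

  <ᵛ-trans : Transitive _<ᵛ_
  <ᵛ-trans {just _} {just _} {just _} p q = <₀-trans p q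
  <ᵛ-trans {just _} {just _} {nothing} _ _ = tt
  <ᵛ-trans {just _} {nothing} {just _} _ ()
  <ᵛ-trans {just _} {nothing} {nothing} _ ()

  <ᵛ-irrefl : Irreflexive _≡_ _<ᵛ_
  <ᵛ-irrefl {just _} refl p = irrefl refl p

  <ᵛ-compare : Trichotomous _≡_ _<ᵛ_
  <ᵛ-compare (just a) (just b) with compare a b
  ... | tri< a<b a≢b b≮a = tri< a<b (λ { refl → a≢b refl }) b≮a
  ... | tri≈ a≮b refl b≮a = tri≈ a≮b refl b≮a
  ... | tri> a≮b a≢b b<a = tri> a≮b (λ { refl → a≢b refl }) b<a
  <ᵛ-compare (just _) nothing = tri< tt (λ ()) (λ ())
  <ᵛ-compare nothing (just _) = tri> (λ ()) (λ ()) tt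
  <ᵛ-compare nothing nothing = tri≈ (λ ()) refl (λ ())

  open StrictToNonStrict _≡_ _<ᵛ_ using ()
    renaming (trans to ≤-trans; antisym to ≤-antisym; <-≤-trans to <-≤-trans)

  -- _<ᵛ_ computes by pattern matching on its arguments, so they have to be given explicitly.
  ≤ᵛ-trans : Transitive _≤ᵛ_
  ≤ᵛ-trans {p} {q} {r} =
    ≤-trans isEquivalence (resp₂ _<ᵛ_) (λ {p q r} → <ᵛ-trans {p} {q} {r}) {p} {q} {r}

  ≤ᵛ-antisym : ∀ {p q} → p ≤ᵛ q → q ≤ᵛ p → p ≡ q
  ≤ᵛ-antisym {p} {q} =
    ≤-antisym isEquivalence (λ {p q r} → <ᵛ-trans {p} {q} {r}) (λ {p q} → <ᵛ-irrefl {p} {q}) {p} {q}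

  <ᵛ-≤ᵛ-trans : ∀ {p q r} → p <ᵛ q → q ≤ᵛ r → p <ᵛ r
  <ᵛ-≤ᵛ-trans {p} {q} {r} =
    <-≤-trans (λ {p q r} → <ᵛ-trans {p} {q} {r}) (λ { refl p<q → p<q }) {p} {q} {r}

  v-0 : v 0ᴳ ≡ nothing
  v-0 = Equivalence.from (v-∞ 0ᴳ) refl

  v-neg : ∀ x → v (-ᴳ x) ≡ v x
  v-neg x = trans (cong v (sym (-1·x≡-x x))) (v-scal (- 1#) x (x<0⇒x≢0 -1<0))

  v-+-absorbˡ : ∀ {x y} → v x <ᵛ v y → v (x +ᴳ y) ≡ v x
  v-+-absorbˡ {x} {y} vx<vy = ≤ᵛ-antisym upper lower
    where
    lower : v x ≤ᵛ v (x +ᴳ y)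
    lower with v-ultra x y
    ... | inj₁ vx≤ = vx≤
    ... | inj₂ vy≤ = inj₁ (<ᵛ-≤ᵛ-trans {v x} {v y} vx<vy vy≤)
    upper : v (x +ᴳ y) ≤ᵛ v x
    upper with v-ultra (x +ᴳ y) (-ᴳ y)
    ... | inj₁ le = subst (v (x +ᴳ y) ≤ᵛ_) (cong v (//-rightDividesʳ y x)) le
    ... | inj₂ le = ⊥-elim (<ᵛ-irrefl {v x} refl
          (<ᵛ-≤ᵛ-trans {v x} {v y} vx<vy (subst₂ _≤ᵛ_ (v-neg y) (cong v (//-rightDividesʳ y x)) le)))

  v-+-≢ : ∀ {x y} → v x ≢ v y → v (x +ᴳ y) ≡ v x ⊎ v (x +ᴳ y) ≡ v y
  v-+-≢ {x} {y} vx≢vy with <ᵛ-compare (v x) (v y)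
  ... | tri< vx<vy _ _ = inj₁ (v-+-absorbˡ vx<vy)
  ... | tri≈ _ vx≡vy _ = ⊥-elim (vx≢vy vx≡vy)
  ... | tri> _ _ vy<vx = inj₂ (trans (cong v (+ᴹ-comm x y)) (v-+-absorbˡ vy<vx))

  -- The conjunct var zero <₀′ inf′ excludes the point ∞ of the universe G ∪ {∞}.
  definable-in-G : ∀ {n} (ψ : Fm (AtomHam C) (suc n)) (ps : Fin n → Maybe G) (P : G → Set) →
                   (∀ g → SatM ψ (just g ∷ᵛ ps) ⇔ P g) → Definable P
  definable-in-G ψ ps P ψ⇔P = _ , atom (var zero <₀′ inf′) ∧′ ψ , ps , sat
    where
    sat : ∀ x → SatM (atom (var zero <₀′ inf′) ∧′ ψ) (x ∷ᵛ ps) ⇔ InG P x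
    sat (just g) = mk⇔ (Equivalence.to (ψ⇔P g) ∘ proj₂) (λ p → tt , Equivalence.from (ψ⇔P g) p)
    sat nothing = mk⇔ (λ ()) (λ ())

  Fixed : G → Set
  Fixed g = v g ≡ just g

  v-fixed : ∀ {c g} → v c ≡ just g → Fixed g
  v-fixed {c} {g} vc≡g = trans (v-idem c g vc≡g) vc≡g

  Fixed-definable : Definable Fixed
  Fixed-definable = definable-in-G {0} (atom (val (var zero) ≐ var zero)) (λ ()) Fixed
    (λ _ → ⇔.refl)

  Fixed-dense : DenseIn₀ Fixed
  Fixed-dense a b a<b with dense a b a<b
  ... | c , a<vc , vc<b with v c in vc≡g
  ... | just g = g , v-fixed vc≡g , a<vc , vc<b

  lincomb-∷-zero : ∀ h xs → lincomb ((0# , h) ∷ xs) ≡ lincomb xs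
  lincomb-∷-zero h xs = trans (cong (_+ᴳ lincomb xs) (*ₗ-zeroˡ h)) (+ᴹ-identityˡ (lincomb xs))

  lincomb-zeros : ∀ xs → All (λ p → proj₁ p ≡ 0#) xs → lincomb xs ≡ 0ᴳ
  lincomb-zeros [] [] = refl
  lincomb-zeros ((_ , h) ∷ xs) (refl ∷ zeros) = trans (lincomb-∷-zero h xs) (lincomb-zeros xs zeros)

  v-·-Fixed : ∀ {c h} → c ≢ 0# → Fixed h → v (c · h) ≡ just h
  v-·-Fixed {c} {h} c≢0 fixed-h = trans (v-scal c h c≢0) fixed-h

  v-lincomb : ∀ xs → Unique (map proj₂ xs) → All (Fixed ∘ proj₂) xs →
              All (λ p → proj₁ p ≡ 0#) xs ⊎ Σ[ h ∈ G ] (h ∈ map proj₂ xs × v (lincomb xs) ≡ just h)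
  v-lincomb [] _ _ = inj₁ []
  v-lincomb ((c , h) ∷ xs) (h∉xs ∷ unique) (fixed-h ∷ fixed)
    with c C≟ 0# | v-lincomb xs unique fixed
  ... | yes refl | inj₁ zeros = inj₁ (refl ∷ zeros)
  ... | yes refl | inj₂ (h′ , h′∈xs , v≡h′) =
    inj₂ (h′ , there h′∈xs , trans (cong v (lincomb-∷-zero h xs)) v≡h′)
  ... | no c≢0 | inj₁ zeros =
    inj₂ (h , here refl , trans (cong v (trans (cong (c · h +ᴳ_) (lincomb-zeros xs zeros)) (+ᴹ-identityʳ _)))
                                (v-·-Fixed c≢0 fixed-h))
  ... | no c≢0 | inj₂ (h′ , h′∈xs , v≡h′)
    with v-+-≢ {c · h} {lincomb xs}
           (λ v≡ → All.lookup h∉xs h′∈xs (just-injective (trans (sym (v-·-Fixed c≢0 fixed-h)) (trans v≡ v≡h′))))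
  ...   | inj₁ v≡vch = inj₂ (h , here refl , trans v≡vch (v-·-Fixed c≢0 fixed-h))
  ...   | inj₂ v≡rest = inj₂ (h′ , there h′∈xs , trans v≡rest v≡h′)

  Fixed-linearlyIndependent : LinearlyIndependent Fixed
  Fixed-linearlyIndependent xs unique fixed lincomb≡0 with v-lincomb xs unique fixed
  ... | inj₁ zeros = zeros
  ... | inj₂ (h , _ , v≡h) with trans (sym v≡h) (trans (cong v lincomb≡0) v-0)
  ...   | ()

  Ball : G → G → Set
  Ball γ g = just γ ≤ᵛ v g

  Ball-definable : ∀ γ → Definable (Ball γ)
  Ball-definable γ = definable-in-G {1}
    (atom (var (suc zero) <₀′ val (var zero)) ∨′ atom (var (suc zero) ≐ val (var zero)))
    (λ _ → just γ) (Ball γ) (λ _ → ⇔.refl)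

  Ball-+ : ∀ {γ a b} → Ball γ a → Ball γ b → Ball γ (a +ᴳ b)
  Ball-+ {γ} {a} {b} γ≤va γ≤vb with v-ultra a b
  ... | inj₁ va≤ = ≤ᵛ-trans {just γ} {v a} γ≤va va≤
  ... | inj₂ vb≤ = ≤ᵛ-trans {just γ} {v b} γ≤vb vb≤

  Ball-· : ∀ {γ} c {a} → Ball γ a → Ball γ (c · a)
  Ball-· {γ} c {a} γ≤va with c C≟ 0#
  ... | yes refl = subst (just γ ≤ᵛ_) (sym (trans (cong v (*ₗ-zeroˡ a)) v-0)) (inj₁ tt)
  ... | no c≢0 = subst (just γ ≤ᵛ_) (sym (v-scal c a c≢0)) γ≤va

  Fixed⇒∈Ball : ∀ {γ} → Fixed γ → Ball γ γ
  Fixed⇒∈Ball fixed = inj₂ (sym fixed)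

  Fixed⇒∉Ball : ∀ {γ δ} → Fixed δ → δ <₀ γ → ¬ Ball γ δ
  Fixed⇒∉Ball {γ} fixed δ<γ γ≤vδ with subst (just γ ≤ᵛ_) fixed γ≤vδ
  ... | inj₁ γ<δ = asym γ<δ δ<γ
  ... | inj₂ refl = irrefl refl δ<γ

  ∃-positive : Σ[ z ∈ G ] 0ᴳ <₀ z
  ∃-positive with independent (fin 0ᴳ) +∞ -∞ +∞ tt tt
  ... | z , 0<z , _ = z , 0<z

  ∃-Fixed-pair : Σ[ γ ∈ G ] Σ[ δ ∈ G ] (Fixed γ × Fixed δ × 0ᴳ <₀ γ × δ <₀ γ)
  ∃-Fixed-pair =
    let (z , 0<z) = ∃-positive
        (γ , fixed-γ , 0<γ , _) = Fixed-dense 0ᴳ z 0<z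
        (δ , fixed-δ , _ , δ<γ) = Fixed-dense 0ᴳ γ 0<γ
    in γ , δ , fixed-γ , fixed-δ , 0<γ , δ<γ

corollary6p1 : ExcludedMiddle 0ℓ → (F : OrderedField) → (𝔾 : HamelSpace F) →
    Corollary6p1-conclusion 𝔾
corollary6p1 em F 𝔾 =
  let open HamelSpaceTheory 𝔾
      (γ , δ , fixed-γ , fixed-δ , 0<γ , δ<γ) = ∃-Fixed-pair
  in (Fixed , Fixed-definable , Fixed-linearlyIndependent , Fixed-dense) ,
     (Ball γ , Ball-definable γ , (δ , Fixed⇒∉Ball fixed-δ δ<γ) ,
      subspace-elementary em (Ball γ) Ball-+ Ball-· (Fixed⇒∈Ball fixed-γ) 0<γ)
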